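{- Let $d$ be a negative square-free integer and let $\mathcal{O}_d$ be the ring of integers of $\mathbb{Q}(\sqrt d)$. Then the frieze subring $\mathcal{O}_d^\circ$ equals $\mathcal{O}_d$ if $d\in\{ -1,-2,-3,-7,-11\}$, and equals $\mathbb{Z}$ otherwise.
   Context: Let $R$ be a subset of a field. A non-zero frieze pattern of height $n\ge0$ over $R$ is a family $(c_{i,j})$, indexed by $i\in\mathbb{Z}$ and $i\le j\le n+i+3$, with $c_{i,i}=c_{i,n+i+3}=0$, $c_{i,i+1}=c_{i,n+i+2}=1$, $c_{i,j}\in R\setminus\{0\}$ for $i+2\le j\le n+i+1$, and $c_{i,j}c_{i+1,j+1}-c_{i,j+1}c_{i+1,j}=1$ for all $i\in\mathbb{Z}$ and $i+1\le j\le n+i+2$. For a subring $R\le\mathbb{C}$, the frieze subring $R^\circ$ is the subring of $R$ generated by all entries of all non-zero frieze patterns (of all heights) over $R$. -}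

module Defs where

open import Data.Bool using (if_then_else_)
open import Data.Integer as ℤ using (ℤ; +_; -_; _≤_; _<_)
open import Data.Integer.DivMod using (_/_; _%ℕ_)
open import Data.Nat as ℕ using (ℕ)
import Data.Nat.Divisibility as ND
open import Data.Product using (Σ; ∃; _×_; _,_)
open import Relation.Binary.PropositionalEquality using (_≡_)
open import Relation.Nullary using (¬_)

SquareFree : ℤ → Set
SquareFree d = ∀ (k : ℕ) → (k ℕ.* k) ND.∣ ℤ.∣ d ∣ → k ≡ 1

-- The ring of integers O_d of Q(√d) has Z-basis {1, ω} with
--   ω = (1 + √d)/2  if d ≡ 1 (mod 4),   ω = √d  otherwise.
-- ω satisfies ω² = t·ω + s where
--   (t , s) = (1 , (d-1)/4)  if d ≡ 1 (mod 4),  (0 , d) otherwise.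
-- An element a + b·ω is represented by the pair (a , b).
ωt : ℤ → ℤ
ωt d = if (d %ℕ 4) ℕ.≡ᵇ 1 then + 1 else + 0

ωs : ℤ → ℤ
ωs d = if (d %ℕ 4) ℕ.≡ᵇ 1 then (d ℤ.- + 1) / (+ 4) else d

record 𝒪 (d : ℤ) : Set where
  constructor ⟨_,_⟩
  field
    re : ℤ
    im : ℤ

module _ {d : ℤ} where
  0𝒪 : 𝒪 d
  0𝒪 = ⟨ + 0 , + 0 ⟩

  1𝒪 : 𝒪 d
  1𝒪 = ⟨ + 1 , + 0 ⟩

  _+𝒪_ : 𝒪 d → 𝒪 d → 𝒪 d
  ⟨ a , b ⟩ +𝒪 ⟨ c , e ⟩ = ⟨ a ℤ.+ c , b ℤ.+ e ⟩

  -𝒪_ : 𝒪 d → 𝒪 d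
  -𝒪 ⟨ a , b ⟩ = ⟨ - a , - b ⟩

  _-𝒪_ : 𝒪 d → 𝒪 d → 𝒪 d
  x -𝒪 y = x +𝒪 (-𝒪 y)

  _*𝒪_ : 𝒪 d → 𝒪 d → 𝒪 d
  ⟨ a , b ⟩ *𝒪 ⟨ c , e ⟩ =
    ⟨ a ℤ.* c ℤ.+ ωs d ℤ.* (b ℤ.* e)
    , a ℤ.* e ℤ.+ b ℤ.* c ℤ.+ ωt d ℤ.* (b ℤ.* e) ⟩

ι : (d : ℤ) → ℤ → 𝒪 d
ι d a = ⟨ a , + 0 ⟩

-- A non-zero frieze pattern of height n over O_d.  The family is given as a
-- function on all of Z × Z; only the entries c i j with i ≤ j ≤ n+i+3 matter.
record Frieze (d : ℤ) (n : ℕ) : Set where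
  field
    c : ℤ → ℤ → 𝒪 d
    zeroˡ : ∀ i → c i i ≡ 0𝒪
    zeroʳ : ∀ i → c i (+ n ℤ.+ i ℤ.+ + 3) ≡ 0𝒪
    oneˡ  : ∀ i → c i (i ℤ.+ + 1) ≡ 1𝒪
    oneʳ  : ∀ i → c i (+ n ℤ.+ i ℤ.+ + 2) ≡ 1𝒪
    nonzero : ∀ i j → i ℤ.+ + 2 ≤ j → j ≤ + n ℤ.+ i ℤ.+ + 1 → ¬ (c i j ≡ 0𝒪)
    unimod : ∀ i j → i ℤ.+ + 1 ≤ j → j ≤ + n ℤ.+ i ℤ.+ + 2 →
      (c i j *𝒪 c (i ℤ.+ + 1) (j ℤ.+ + 1)) -𝒪 (c i (j ℤ.+ + 1) *𝒪 c (i ℤ.+ + 1) j) ≡ 1𝒪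

IsFriezeEntry : (d : ℤ) → 𝒪 d → Set
IsFriezeEntry d x =
  Σ ℕ λ n → Σ (Frieze d n) λ F → Σ ℤ λ i → Σ ℤ λ j →
    (i ≤ j) × (j ≤ + n ℤ.+ i ℤ.+ + 3) × (Frieze.c F i j ≡ x)

data InFriezeSubring (d : ℤ) : 𝒪 d → Set where
  entry : ∀ {x} → IsFriezeEntry d x → InFriezeSubring d x
  zero  : InFriezeSubring d 0𝒪
  one   : InFriezeSubring d 1𝒪
  add   : ∀ {x y} → InFriezeSubring d x → InFriezeSubring d y → InFriezeSubring d (x +𝒪 y)
  neg   : ∀ {x} → InFriezeSubring d x → InFriezeSubring d (-𝒪 x)
  mul   : ∀ {x y} → InFriezeSubring d x → InFriezeSubring d y → InFriezeSubring d (x *𝒪 y)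

Exceptional : ℤ → Set
Exceptional d = (d ≡ - + 1) ⊎' (d ≡ - + 2) ⊎' (d ≡ - + 3) ⊎' (d ≡ - + 7) ⊎' (d ≡ - + 11)
  where open import Data.Sum using () renaming (_⊎_ to _⊎'_)

{-# OPTIONS --safe #-}
module Submission where

-- Write ω² = t ω + s (t = ωt d, s = ωs d) and Δ = t² + 4 s, so that 4 N(u + vω) = (2u + tv)² − Δ v².
-- For negative d outside {−1, −2, −3, −7, −11} one has Δ < −12, hence every element of 𝒪_d outside ℤ
-- has norm at least 4.  Along a diagonal of a frieze of height n the entries are the continuants of the
-- quiddity row a_i = c_{i,i+2}: any n + 2 consecutive a_i have continuant 0 while every shorter run of
-- them has a nonzero continuant.  If all entries of such a run had norm ≥ 4, the continuants would
-- strictly grow in norm (|z p − q| ≥ 2|p| − |q| > |p|), so some entry has norm < 4; being nonzero, it is ±1.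
-- Removing it by (x, ε, y) ↦ (x − ε, y − ε) yields a shorter run with the same properties, so by induction
-- all a_i, and then all entries, lie in ℤ.  For the five exceptional d, alternating quiddity rows (ω, β)
-- with ω β = 2 or 3 give friezes of height 1 or 3 containing ω, which generates 𝒪_d.

open import Defs
open import Algebra.Bundles using (CommutativeRing)
import Algebra.Consequences.Propositional as Consequences
open import Algebra.Definitions using (Associative; Commutative; LeftIdentity; LeftInverse; _DistributesOverˡ_)
import Algebra.Solver.Ring
open import Algebra.Solver.Ring.AlmostCommutativeRing using (fromCommutativeRing; _-Raw-AlmostCommutative⟶_)
open import Algebra.Structures using (IsCommutativeRing)
open import Data.Bool using (Bool; true; false; not; if_then_else_)
open import Data.Bool.Properties using (not-involutive)
import Data.Integer
open import Data.Integer as ℤ using (ℤ; +_; -[1+_]; +[1+_]; +≤+; +<+; -≤-; -<-; _<_)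
open import Data.Integer.DivMod using (_/_; _%_; _%ℕ_; a≡a%n+[a/n]*n)
import Data.Integer.Properties as ℤP
open import Data.Integer.Solver using (module +-*-Solver)
open import Data.Integer.Tactic.RingSolver using (solve-∀)
open import Data.List using (List; []; _∷_; foldr; length)
open import Data.List.Relation.Binary.Infix.Heterogeneous using (Infix; here; there)
open import Data.List.Relation.Binary.Prefix.Heterogeneous using (Prefix; []; _∷_)
open import Data.List.Relation.Unary.All as All using (All; []; _∷_)
open import Data.List.Relation.Unary.Any using (Any; here; there)
open import Data.Maybe using () renaming (map to mapMaybe)
open import Data.Nat as ℕ using (ℕ; zero; suc; z≤n; s≤s)
import Data.Nat.Induction as ℕI
import Data.Nat.Properties as ℕP
open import Data.Product as Product using (_×_; _,_; proj₁; proj₂; ∃; ∃₂)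
open import Data.Sum using ([_,_]′; _⊎_; inj₁; inj₂)
open import Function using (_∘_; id)
open import Function.Bundles using (_⇔_; mk⇔)
import Induction.WellFounded as WF
open import Level using (0ℓ)
import Relation.Binary.Construct.On as On
open import Relation.Binary.PropositionalEquality
open import Relation.Nullary using (¬_; yes; no; contradiction)
open import Relation.Nullary.Decidable using (dec⇒maybe; from-yes)

isEven : ℤ → Bool
isEven (+ zero) = true
isEven (+ suc n) = not (isEven (+ n))
isEven -[1+ zero ] = false
isEven -[1+ suc n ] = not (isEven -[1+ n ])

isEven-suc : ∀ i → isEven (i ℤ.+ + 1) ≡ not (isEven i)
isEven-suc (+ n) = cong (isEven ∘ +_) (ℕP.+-comm n 1)
isEven-suc -[1+ zero ] = refl
isEven-suc -[1+ suc n ] = sym (not-involutive (isEven -[1+ n ]))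

module _ where
  open Data.Integer using (_+_; _-_; -_)

  offset : ∀ i j → i ℤ.≤ j → ∃ λ m → j ≡ i + + m
  offset i j i≤j =
    ℤ.∣ j - i ∣ , trans (j≡i+[j-i] i j) (cong (λ k → i + k) (sym (ℤP.0≤i⇒+∣i∣≡i (ℤP.i≤j⇒0≤j-i i≤j))))
    where
    j≡i+[j-i] : ∀ i j → j ≡ i + (j - i)
    j≡i+[j-i] = solve-∀

  +-cancelˡ-≤ : ∀ i {m n} → i + + m ℤ.≤ i + + n → m ℕ.≤ n
  +-cancelˡ-≤ i {m} {n} i+m≤i+n =
    ℤP.drop‿+≤+ (subst₂ ℤ._≤_ (-i+[i+j]≡j i (+ m)) (-i+[i+j]≡j i (+ n)) (ℤP.+-monoʳ-≤ (- i) i+m≤i+n))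
    where
    -i+[i+j]≡j : ∀ i j → - i + (i + j) ≡ j
    -i+[i+j]≡j = solve-∀

  between : ∀ i j a b → i + + a ℤ.≤ j → j ℤ.≤ i + + b → ∃ λ m → j ≡ i + + m × a ℕ.≤ m × m ℕ.≤ b
  between i j a b lo hi =
    let m , j≡i+m = offset i j (ℤP.≤-trans (ℤP.i≤i+j i (+ a)) lo)
    in m , j≡i+m , +-cancelˡ-≤ i (subst (i + + a ℤ.≤_) j≡i+m lo) , +-cancelˡ-≤ i (subst (ℤ._≤ i + + b) j≡i+m hi)

  [i+j]-i≡j : ∀ i j → (i + j) - i ≡ j
  [i+j]-i≡j = solve-∀

  i+[1+j]≡[i+1]+j : ∀ i j → i + (+ 1 + j) ≡ (i + + 1) + j
  i+[1+j]≡[i+1]+j = solve-∀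

  [i+j]+1≡i+[1+j] : ∀ i j → (i + j) + + 1 ≡ i + (+ 1 + j)
  [i+j]+1≡i+[1+j] = solve-∀

  n+i+k≡i+[k+n] : ∀ k i n → n + i + k ≡ i + (k + n)
  n+i+k≡i+[k+n] = solve-∀

segment : {A : Set} → (ℤ → A) → ℤ → ℕ → List A
segment f i zero = []
segment f i (suc m) = f i ∷ segment f (i ℤ.+ + 1) m

module _ {A : Set} (f : ℤ → A) where

  length-segment : ∀ i m → length (segment f i m) ≡ m
  length-segment i zero = refl
  length-segment i (suc m) = cong suc (length-segment (i ℤ.+ + 1) m)

  prefix-segment : ∀ {w} i m → Prefix _≡_ w (segment f i m) → w ≡ segment f i (length w)
  prefix-segment i zero [] = refl
  prefix-segment i (suc m) [] = refl
  prefix-segment i (suc m) (refl ∷ p) = cong (f i ∷_) (prefix-segment (i ℤ.+ + 1) m p)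

  infix-segment : ∀ {w} i m → Infix _≡_ w (segment f i m) → ∃ λ j → w ≡ segment f j (length w)
  infix-segment i zero (here p) = i , prefix-segment i zero p
  infix-segment i (suc m) (here p) = i , prefix-segment i (suc m) p
  infix-segment i (suc m) (there p) = infix-segment (i ℤ.+ + 1) m p

  All-segment : ∀ {P : A → Set} → (∀ j → P (f j)) → ∀ i m → All P (segment f i m)
  All-segment Pf i zero = []
  All-segment Pf i (suc m) = Pf i ∷ All-segment Pf (i ℤ.+ + 1) m

-- The ring 𝒪 d

-- Polynomial copies of the operations of 𝒪 d on coordinates (a , b) ↦ a + bω, with ωs d and ωt d as
-- variables s and t, so that the ℤ-solver can check identities in 𝒪 d coordinatewise.
private
  module Coordinates {n : ℕ} (s t : +-*-Solver.Polynomial n) where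
    open +-*-Solver

    Pair : Set
    Pair = Polynomial n × Polynomial n

    _⊠_ : Pair → Pair → Pair
    (a , b) ⊠ (c , e) = (a :* c :+ s :* (b :* e) , a :* e :+ b :* c :+ t :* (b :* e))

    _⊞_ : Pair → Pair → Pair
    (a , b) ⊞ (c , e) = (a :+ c , b :+ e)

    _⊟_ : Pair → Pair → Pair
    (a , b) ⊟ (c , e) = (a :- c , b :- e)

    norm : Pair → Polynomial n
    norm (u , v) = u :* u :+ t :* (u :* v) :- s :* (v :* v)

discriminant : ℤ → ℤ
discriminant d = ωt d ℤ.* ωt d ℤ.+ + 4 ℤ.* ωs d

module _ {d : ℤ} where

  module _ where
    open +-*-Solver using (solve; _:=_; con; _:*_)

    +𝒪-assoc : Associative {A = 𝒪 d} _≡_ _+𝒪_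
    +𝒪-assoc ⟨ a , b ⟩ ⟨ c , e ⟩ ⟨ f , g ⟩ = cong₂ ⟨_,_⟩ (ℤP.+-assoc a c f) (ℤP.+-assoc b e g)

    +𝒪-comm : Commutative {A = 𝒪 d} _≡_ _+𝒪_
    +𝒪-comm ⟨ a , b ⟩ ⟨ c , e ⟩ = cong₂ ⟨_,_⟩ (ℤP.+-comm a c) (ℤP.+-comm b e)

    +𝒪-identityˡ : LeftIdentity {A = 𝒪 d} _≡_ 0𝒪 _+𝒪_
    +𝒪-identityˡ ⟨ a , b ⟩ = cong₂ ⟨_,_⟩ (ℤP.+-identityˡ a) (ℤP.+-identityˡ b)

    -𝒪‿inverseˡ : LeftInverse {A = 𝒪 d} _≡_ 0𝒪 -𝒪_ _+𝒪_
    -𝒪‿inverseˡ ⟨ a , b ⟩ = cong₂ ⟨_,_⟩ (ℤP.+-inverseˡ a) (ℤP.+-inverseˡ b)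

    *𝒪-comm : Commutative {A = 𝒪 d} _≡_ _*𝒪_
    *𝒪-comm ⟨ a , b ⟩ ⟨ c , e ⟩ = cong₂ ⟨_,_⟩
      (solve 6 (λ a b c e s t → let open Coordinates s t in
                  proj₁ ((a , b) ⊠ (c , e)) := proj₁ ((c , e) ⊠ (a , b)))
               refl a b c e (ωs d) (ωt d))
      (solve 6 (λ a b c e s t → let open Coordinates s t in
                  proj₂ ((a , b) ⊠ (c , e)) := proj₂ ((c , e) ⊠ (a , b)))
               refl a b c e (ωs d) (ωt d))

    *𝒪-assoc : Associative {A = 𝒪 d} _≡_ _*𝒪_
    *𝒪-assoc ⟨ a , b ⟩ ⟨ c , e ⟩ ⟨ f , g ⟩ = cong₂ ⟨_,_⟩
      (solve 8 (λ a b c e f g s t → let open Coordinates s t in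
                  proj₁ (((a , b) ⊠ (c , e)) ⊠ (f , g)) := proj₁ ((a , b) ⊠ ((c , e) ⊠ (f , g))))
               refl a b c e f g (ωs d) (ωt d))
      (solve 8 (λ a b c e f g s t → let open Coordinates s t in
                  proj₂ (((a , b) ⊠ (c , e)) ⊠ (f , g)) := proj₂ ((a , b) ⊠ ((c , e) ⊠ (f , g))))
               refl a b c e f g (ωs d) (ωt d))

    *𝒪-identityˡ : LeftIdentity {A = 𝒪 d} _≡_ 1𝒪 _*𝒪_
    *𝒪-identityˡ ⟨ a , b ⟩ = cong₂ ⟨_,_⟩
      (solve 4 (λ a b s t → let open Coordinates s t in proj₁ ((con (+ 1) , con (+ 0)) ⊠ (a , b)) := a)
               refl a b (ωs d) (ωt d))
      (solve 4 (λ a b s t → let open Coordinates s t in proj₂ ((con (+ 1) , con (+ 0)) ⊠ (a , b)) := b)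
               refl a b (ωs d) (ωt d))

    *𝒪-distribˡ-+𝒪 : _DistributesOverˡ_ {A = 𝒪 d} _≡_ _*𝒪_ _+𝒪_
    *𝒪-distribˡ-+𝒪 ⟨ a , b ⟩ ⟨ c , e ⟩ ⟨ f , g ⟩ = cong₂ ⟨_,_⟩
      (solve 8 (λ a b c e f g s t → let open Coordinates s t in
                  proj₁ ((a , b) ⊠ ((c , e) ⊞ (f , g))) := proj₁ (((a , b) ⊠ (c , e)) ⊞ ((a , b) ⊠ (f , g))))
               refl a b c e f g (ωs d) (ωt d))
      (solve 8 (λ a b c e f g s t → let open Coordinates s t in
                  proj₂ ((a , b) ⊠ ((c , e) ⊞ (f , g))) := proj₂ (((a , b) ⊠ (c , e)) ⊞ ((a , b) ⊠ (f , g))))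
               refl a b c e f g (ωs d) (ωt d))

    ι-* : ∀ a b → ι d (a ℤ.* b) ≡ (ι d a *𝒪 ι d b)
    ι-* a b = cong₂ ⟨_,_⟩
      (solve 4 (λ a b s t → let open Coordinates s t in a :* b := proj₁ ((a , con (+ 0)) ⊠ (b , con (+ 0))))
               refl a b (ωs d) (ωt d))
      (solve 4 (λ a b s t → let open Coordinates s t in con (+ 0) := proj₂ ((a , con (+ 0)) ⊠ (b , con (+ 0))))
               refl a b (ωs d) (ωt d))

  𝒪-isCommutativeRing : IsCommutativeRing _≡_ _+𝒪_ _*𝒪_ -𝒪_ 0𝒪 1𝒪
  𝒪-isCommutativeRing = record
    { isRing = record
      { +-isAbelianGroup = record
        { isGroup = record
          { isMonoid = record
            { isSemigroup = record
              { isMagma = record { isEquivalence = isEquivalence ; ∙-cong = cong₂ _+𝒪_ }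
              ; assoc = +𝒪-assoc
              }
            ; identity = Consequences.comm∧idˡ⇒id +𝒪-comm +𝒪-identityˡ
            }
          ; inverse = Consequences.comm∧invˡ⇒inv +𝒪-comm -𝒪‿inverseˡ
          ; ⁻¹-cong = cong (-𝒪_)
          }
        ; comm = +𝒪-comm
        }
      ; *-cong = cong₂ _*𝒪_
      ; *-assoc = *𝒪-assoc
      ; *-identity = Consequences.comm∧idˡ⇒id *𝒪-comm *𝒪-identityˡ
      ; distrib = *𝒪-distribˡ-+𝒪 , Consequences.comm∧distrˡ⇒distrʳ *𝒪-comm *𝒪-distribˡ-+𝒪
      }
    ; *-comm = *𝒪-comm
    }

  𝒪-commutativeRing : CommutativeRing 0ℓ 0ℓ
  𝒪-commutativeRing = record { isCommutativeRing = 𝒪-isCommutativeRing }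

  ι-morphism : ℤ.+-*-rawRing -Raw-AlmostCommutative⟶ fromCommutativeRing 𝒪-commutativeRing
  ι-morphism = record
    { ⟦_⟧ = ι d ; +-homo = λ _ _ → refl ; *-homo = ι-* ; -‿homo = λ _ → refl ; 0-homo = refl ; 1-homo = refl }

  module 𝒪-Solver = Algebra.Solver.Ring ℤ.+-*-rawRing (fromCommutativeRing 𝒪-commutativeRing) ι-morphism
    (λ a b → mapMaybe (cong (ι d)) (dec⇒maybe (a ℤ.≟ b)))

  IsUnit : 𝒪 d → Set
  IsUnit ε = ε ≡ 1𝒪 ⊎ ε ≡ -𝒪 1𝒪

  _∈ℤ : 𝒪 d → Set
  x ∈ℤ = 𝒪.im x ≡ + 0

  ∈ℤ⇒ι : ∀ x → x ∈ℤ → x ≡ ι d (𝒪.re x)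
  ∈ℤ⇒ι ⟨ _ , _ ⟩ refl = refl

  ∈ℤ-+ : ∀ x y → x ∈ℤ → y ∈ℤ → (x +𝒪 y) ∈ℤ
  ∈ℤ-+ _ _ refl refl = refl

  ∈ℤ-neg : ∀ x → x ∈ℤ → (-𝒪 x) ∈ℤ
  ∈ℤ-neg _ refl = refl

  ∈ℤ-* : ∀ x y → x ∈ℤ → y ∈ℤ → (x *𝒪 y) ∈ℤ
  ∈ℤ-* ⟨ a , _ ⟩ _ refl refl = cong₂ ℤ._+_ (cong (ℤ._+ + 0) (ℤP.*-zeroʳ a)) (ℤP.*-zeroʳ (ωt d))

  x-y∈ℤ⇒x∈ℤ : ∀ x y → y ∈ℤ → (x -𝒪 y) ∈ℤ → x ∈ℤ
  x-y∈ℤ⇒x∈ℤ ⟨ _ , b ⟩ _ refl b+0≡0 = trans (sym (ℤP.+-identityʳ b)) b+0≡0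

  unit-∈ℤ : ∀ {ε} → IsUnit ε → ε ∈ℤ
  unit-∈ℤ (inj₁ refl) = refl
  unit-∈ℤ (inj₂ refl) = refl

  -- Norms

  module _ where
    open Data.Integer using (_+_; _*_; _-_; -_)
    open +-*-Solver using (solve; _:=_; con; _:*_; _:+_; :-_)

    -- (u + vω)(u + vω̄), where ω + ω̄ = ωt d and ω ω̄ = − ωs d
    N : 𝒪 d → ℤ
    N ⟨ u , v ⟩ = u * u + ωt d * (u * v) - ωs d * (v * v)

    Tr : 𝒪 d → ℤ
    Tr ⟨ u , v ⟩ = + 2 * u + ωt d * v

    N-* : ∀ x y → N (x *𝒪 y) ≡ N x * N y
    N-* ⟨ a , b ⟩ ⟨ c , e ⟩ =
      solve 6 (λ a b c e s t → let open Coordinates s t in norm ((a , b) ⊠ (c , e)) := norm (a , b) :* norm (c , e))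
        refl a b c e (ωs d) (ωt d)

    N-parallelogram : ∀ x y → N (x +𝒪 y) + N (x -𝒪 y) ≡ + 2 * N x + + 2 * N y
    N-parallelogram ⟨ a , b ⟩ ⟨ c , e ⟩ =
      solve 6 (λ a b c e s t → let open Coordinates s t in
                 norm ((a , b) ⊞ (c , e)) :+ norm ((a , b) ⊟ (c , e))
                 := con (+ 2) :* norm (a , b) :+ con (+ 2) :* norm (c , e))
        refl a b c e (ωs d) (ωt d)

    N-ι : ∀ a → N (ι d a) ≡ a * a
    N-ι a = solve 3 (λ a s t → let open Coordinates s t in norm (a , con (+ 0)) := a :* a) refl a (ωs d) (ωt d)

    4N≡Tr²-Δv² : ∀ u v → + 4 * N ⟨ u , v ⟩ ≡ Tr ⟨ u , v ⟩ * Tr ⟨ u , v ⟩ + - discriminant d * (v * v)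
    4N≡Tr²-Δv² u v =
      solve 4 (λ u v s t → let open Coordinates s t in
                 con (+ 4) :* norm (u , v)
                 := (con (+ 2) :* u :+ t :* v) :* (con (+ 2) :* u :+ t :* v) :+ :- (t :* t :+ con (+ 4) :* s) :* (v :* v))
        refl u v (ωs d) (ωt d)

    N-unit : ∀ {ε} → IsUnit ε → N ε ≡ + 1
    N-unit (inj₁ refl) = N-ι (+ 1)
    N-unit (inj₂ refl) = N-ι (- + 1)

    private
      4≤[2+k]² : ∀ k → 4 ℕ.≤ (2 ℕ.+ k) ℕ.* (2 ℕ.+ k)
      4≤[2+k]² k = ℕP.*-mono-≤ (s≤s (s≤s (z≤n {k}))) (s≤s (s≤s (z≤n {k})))

    u*u<4⇒ι≡0∨unit : ∀ u → u * u ℤ.< + 4 → ι d u ≡ 0𝒪 ⊎ IsUnit (ι d u)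
    u*u<4⇒ι≡0∨unit (+ 0) _ = inj₁ refl
    u*u<4⇒ι≡0∨unit (+ 1) _ = inj₂ (inj₁ refl)
    u*u<4⇒ι≡0∨unit -[1+ 0 ] _ = inj₂ (inj₂ refl)
    u*u<4⇒ι≡0∨unit (+ suc (suc k)) (+<+ u*u<4) = contradiction (4≤[2+k]² k) (ℕP.<⇒≱ u*u<4)
    u*u<4⇒ι≡0∨unit -[1+ suc k ] (+<+ u*u<4) = contradiction (4≤[2+k]² k) (ℕP.<⇒≱ u*u<4)

    module _ (Δ<-12 : discriminant d ℤ.< - + 12) where
      private
        D : ℤ
        D = - discriminant d

        instance
          D-nonNeg : ℤ.NonNegative D
          D-nonNeg = ℤ.nonNegative (ℤP.<⇒≤ (ℤP.<-trans (+<+ (s≤s z≤n)) (ℤP.neg-mono-< Δ<-12)))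

        0≤i*i : ∀ i → + 0 ℤ.≤ i * i
        0≤i*i (+ n) = subst (+ 0 ℤ.≤_) (ℤP.pos-* n n) (+≤+ z≤n)
        0≤i*i -[1+ n ] = +≤+ z≤n

        0≤D*v*v : ∀ v → + 0 ℤ.≤ D * (v * v)
        0≤D*v*v v = subst (ℤ._≤ D * (v * v)) (ℤP.*-zeroʳ D) (ℤP.*-monoˡ-≤-nonNeg D (0≤i*i v))

      0≤N : ∀ x → + 0 ℤ.≤ N x
      0≤N ⟨ u , v ⟩ =
        0≤4i⇒0≤i (subst (+ 0 ℤ.≤_) (sym (4N≡Tr²-Δv² u v)) (ℤP.+-mono-≤ (0≤i*i (Tr ⟨ u , v ⟩)) (0≤D*v*v v)))
        where
        0≤4i⇒0≤i : ∀ {i} → + 0 ℤ.≤ + 4 * i → + 0 ℤ.≤ i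
        0≤4i⇒0≤i {+ _} _ = +≤+ z≤n
        0≤4i⇒0≤i { -[1+ _ ]} ()

      im≢0⇒4≤N : ∀ u v → v ≢ + 0 → + 4 ℤ.≤ N ⟨ u , v ⟩
      im≢0⇒4≤N u v v≢0 = 3<i⇒4≤i (ℤP.*-cancelˡ-<-nonNeg (+ 4) (begin-strict
        + 12                                   <⟨ ℤP.neg-mono-< Δ<-12 ⟩
        D                                      ≡⟨ ℤP.*-identityʳ D ⟨
        D * + 1                                ≤⟨ ℤP.*-monoˡ-≤-nonNeg D (1≤v*v v≢0) ⟩
        D * (v * v)                            ≤⟨ ℤP.i≤j+i _ _ {{ℤ.nonNegative (0≤i*i (Tr ⟨ u , v ⟩))}} ⟩
        Tr ⟨ u , v ⟩ * Tr ⟨ u , v ⟩ + D * (v * v) ≡⟨ 4N≡Tr²-Δv² u v ⟨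
        + 4 * N ⟨ u , v ⟩                      ∎))
        where
        open ℤP.≤-Reasoning
        1≤v*v : ∀ {i} → i ≢ + 0 → + 1 ℤ.≤ i * i
        1≤v*v {+ zero} i≢0 = contradiction refl i≢0
        1≤v*v {+[1+ n ]} _ = +≤+ (s≤s z≤n)
        1≤v*v { -[1+ n ]} _ = +≤+ (s≤s z≤n)
        3<i⇒4≤i : ∀ {i} → + 3 ℤ.< i → + 4 ℤ.≤ i
        3<i⇒4≤i (+<+ 3<n) = +≤+ 3<n

      N<4⇒≡0∨unit : ∀ x → N x ℤ.< + 4 → x ≡ 0𝒪 ⊎ IsUnit x
      N<4⇒≡0∨unit ⟨ u , v ⟩ N<4 with v ℤ.≟ + 0
      ... | no v≢0 = contradiction (im≢0⇒4≤N u v v≢0) (ℤP.<⇒≱ N<4)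
      ... | yes refl = u*u<4⇒ι≡0∨unit u (subst (ℤ._< + 4) (N-ι u) N<4)

      N≡0⇒≡0 : ∀ x → N x ≡ + 0 → x ≡ 0𝒪
      N≡0⇒≡0 x N≡0 with N<4⇒≡0∨unit x (subst (ℤ._< + 4) (sym N≡0) (+<+ (s≤s z≤n)))
      ... | inj₁ x≡0 = x≡0
      ... | inj₂ unit = contradiction (trans (sym (N-unit unit)) N≡0) λ ()

      x*y≡0∧x≢0⇒y≡0 : ∀ x y → (x *𝒪 y) ≡ 0𝒪 → x ≢ 0𝒪 → y ≡ 0𝒪
      x*y≡0∧x≢0⇒y≡0 x y xy≡0 x≢0 =
        [ (λ Nx≡0 → contradiction (N≡0⇒≡0 x Nx≡0) x≢0) , N≡0⇒≡0 y ]′ (ℤP.i*j≡0⇒i≡0∨j≡0 (N x) {N y} NxNy≡0)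
        where
        NxNy≡0 : N x * N y ≡ + 0
        NxNy≡0 = trans (sym (N-* x y)) (trans (cong N xy≡0) (N-ι (+ 0)))

      N-growth : ∀ z p q → + 4 ℤ.≤ N z → N q ℤ.< N p → N p ℤ.< N ((z *𝒪 p) -𝒪 q)
      N-growth z p q 4≤Nz Nq<Np = ℤP.≰⇒> λ Nu≤Np → ℤP.<-irrefl refl (begin-strict
        + 2 * N u + + 2 * N q     ≤⟨ ℤP.+-monoˡ-≤ (+ 2 * N q) (ℤP.*-monoˡ-≤-nonNeg (+ 2) Nu≤Np) ⟩
        + 2 * N p + + 2 * N q     <⟨ ℤP.+-monoʳ-< (+ 2 * N p) (ℤP.*-monoˡ-<-pos (+ 2) Nq<Np) ⟩
        + 2 * N p + + 2 * N p     ≡⟨ ℤP.*-distribʳ-+ (N p) (+ 2) (+ 2) ⟨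
        + 4 * N p                 ≤⟨ ℤP.*-monoʳ-≤-nonNeg (N p) {{ℤ.nonNegative (0≤N p)}} 4≤Nz ⟩
        N z * N p                 ≡⟨ N-* z p ⟨
        N (z *𝒪 p)                ≤⟨ ℤP.i≤i+j _ _ {{ℤ.nonNegative (0≤N (u -𝒪 q))}} ⟩
        N (z *𝒪 p) + N (u -𝒪 q)  ≡⟨ cong (λ w → N w + N (u -𝒪 q)) u+q≡zp ⟨
        N (u +𝒪 q) + N (u -𝒪 q)  ≡⟨ N-parallelogram u q ⟩
        + 2 * N u + + 2 * N q     ∎)
        where
        open ℤP.≤-Reasoning
        open import Algebra.Properties.Group (CommutativeRing.+-group 𝒪-commutativeRing) using (//-rightDividesˡ)
        u : 𝒪 d
        u = (z *𝒪 p) -𝒪 q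
        u+q≡zp : (u +𝒪 q) ≡ (z *𝒪 p)
        u+q≡zp = //-rightDividesˡ q (z *𝒪 p)

  module _ where
    open CommutativeRing 𝒪-commutativeRing
      using (_+_; _*_; -_; _-_; 0#; 1#; *-identityˡ; *-comm) renaming (zeroˡ to *-zeroˡ; zeroʳ to *-zeroʳ)
    open 𝒪-Solver using (solve; _:=_; con; _:*_; _:+_; _:-_; :-_)

    -- Continuants

    private
      module Vectors {n : ℕ} where
        open 𝒪-Solver using (Polynomial)

        stepᴾ : Polynomial n → Polynomial n × Polynomial n → Polynomial n × Polynomial n
        stepᴾ c (p , q) = (c :* p :- q , p)

    step : 𝒪 d → 𝒪 d × 𝒪 d → 𝒪 d × 𝒪 d
    step c (p , q) = (c * p - q , p)

    _·_ : 𝒪 d → 𝒪 d × 𝒪 d → 𝒪 d × 𝒪 d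
    σ · (p , q) = (σ * p , σ * q)

    -- K₂ (c₁ ∷ ⋯ ∷ cₘ) = M c₁ ⋯ M cₘ (1 , 0) with M c = (c −1 ; 1 0); its first entry is the continuant.
    K₂ : List (𝒪 d) → 𝒪 d × 𝒪 d
    K₂ = foldr step (1# , 0#)

    K : List (𝒪 d) → 𝒪 d
    K l = proj₁ (K₂ l)

    step-· : ∀ c σ v → step c (σ · v) ≡ σ · step c v
    step-· c σ (p , q) =
      cong (_, σ * p) (solve 4 (λ c σ p q → c :* (σ :* p) :- σ :* q := σ :* (c :* p :- q)) refl c σ p q)

    ·-identityˡ : ∀ v → 1# · v ≡ v
    ·-identityˡ (p , q) = cong₂ _,_ (*-identityˡ p) (*-identityˡ q)

    K-singleton : ∀ c → K (c ∷ []) ≡ c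
    K-singleton c = solve 1 (λ c → c :* con (+ 1) :- con (+ 0) := c) refl c

    K₂-∈ℤ : ∀ {l} → All _∈ℤ l → proj₁ (K₂ l) ∈ℤ × proj₂ (K₂ l) ∈ℤ
    K₂-∈ℤ [] = refl , refl
    K₂-∈ℤ {c ∷ l} (c∈ℤ ∷ l∈ℤ) =
      let p∈ℤ , q∈ℤ = K₂-∈ℤ l∈ℤ
      in ∈ℤ-+ (c * K l) (- proj₂ (K₂ l)) (∈ℤ-* c (K l) c∈ℤ p∈ℤ) (∈ℤ-neg (proj₂ (K₂ l)) q∈ℤ) , p∈ℤ

    unit-involutive : ∀ {ε} → IsUnit ε → ∀ x → ε * (ε * x) ≡ x
    unit-involutive (inj₁ refl) = solve 1 (λ x → con (+ 1) :* (con (+ 1) :* x) := x) refl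
    unit-involutive (inj₂ refl) = solve 1 (λ x → :- con (+ 1) :* (:- con (+ 1) :* x) := x) refl

    unit*x≡0⇒x≡0 : ∀ {ε x} → IsUnit ε → ε * x ≡ 0# → x ≡ 0#
    unit*x≡0⇒x≡0 {ε} {x} u εx≡0 = trans (sym (unit-involutive u x)) (trans (cong (ε *_) εx≡0) (*-zeroʳ ε))

    step-unit : ∀ {ε} → IsUnit ε → ∀ x y v → step x (step ε (step y v)) ≡ ε · step (x - ε) (step (y - ε) v)
    step-unit (inj₁ refl) x y (p , q) = cong₂ _,_
      (solve 4 (λ x y p q → let open Vectors in
                  proj₁ (stepᴾ x (stepᴾ (con (+ 1)) (stepᴾ y (p , q))))
                  := con (+ 1) :* proj₁ (stepᴾ (x :- con (+ 1)) (stepᴾ (y :- con (+ 1)) (p , q))))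
               refl x y p q)
      (solve 4 (λ x y p q → let open Vectors in
                  proj₂ (stepᴾ x (stepᴾ (con (+ 1)) (stepᴾ y (p , q))))
                  := con (+ 1) :* proj₂ (stepᴾ (x :- con (+ 1)) (stepᴾ (y :- con (+ 1)) (p , q))))
               refl x y p q)
    step-unit (inj₂ refl) x y (p , q) = cong₂ _,_
      (solve 4 (λ x y p q → let open Vectors in
                  proj₁ (stepᴾ x (stepᴾ (:- con (+ 1)) (stepᴾ y (p , q))))
                  := :- con (+ 1) :* proj₁ (stepᴾ (x :- :- con (+ 1)) (stepᴾ (y :- :- con (+ 1)) (p , q))))
               refl x y p q)
      (solve 4 (λ x y p q → let open Vectors in
                  proj₂ (stepᴾ x (stepᴾ (:- con (+ 1)) (stepᴾ y (p , q))))
                  := :- con (+ 1) :* proj₂ (stepᴾ (x :- :- con (+ 1)) (stepᴾ (y :- :- con (+ 1)) (p , q))))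
               refl x y p q)

    step-unit-last : ∀ {ε} → IsUnit ε → ∀ x → step x (step ε (1# , 0#)) ≡ ε · step (x - ε) (1# , 0#)
    step-unit-last (inj₁ refl) x = cong₂ _,_
      (solve 1 (λ x → let open Vectors in
                  proj₁ (stepᴾ x (stepᴾ (con (+ 1)) (con (+ 1) , con (+ 0))))
                  := con (+ 1) :* proj₁ (stepᴾ (x :- con (+ 1)) (con (+ 1) , con (+ 0))))
               refl x)
      (solve 1 (λ x → let open Vectors in
                  proj₂ (stepᴾ x (stepᴾ (con (+ 1)) (con (+ 1) , con (+ 0))))
                  := con (+ 1) :* proj₂ (stepᴾ (x :- con (+ 1)) (con (+ 1) , con (+ 0))))
               refl x)
    step-unit-last (inj₂ refl) x = cong₂ _,_
      (solve 1 (λ x → let open Vectors in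
                  proj₁ (stepᴾ x (stepᴾ (:- con (+ 1)) (con (+ 1) , con (+ 0))))
                  := :- con (+ 1) :* proj₁ (stepᴾ (x :- :- con (+ 1)) (con (+ 1) , con (+ 0))))
               refl x)
      (solve 1 (λ x → let open Vectors in
                  proj₂ (stepᴾ x (stepᴾ (:- con (+ 1)) (con (+ 1) , con (+ 0))))
                  := :- con (+ 1) :* proj₂ (stepᴾ (x :- :- con (+ 1)) (con (+ 1) , con (+ 0))))
               refl x)

    -- Quiddity sequences

    InfixLift : List (𝒪 d) → List (𝒪 d) → Set
    InfixLift l l′ = ∀ {w′} → Infix _≡_ w′ l′ →
      ∃₂ λ w σ → Infix _≡_ w l × length w ℕ.≤ suc (length w′) × K w ≡ σ * K w′

    PrefixLift : List (𝒪 d) → List (𝒪 d) → Set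
    PrefixLift l l′ = ∀ {w′} → Prefix _≡_ w′ l′ →
      ∃₂ λ w σ → Prefix _≡_ w l × length w ℕ.≤ suc (length w′) × K₂ w ≡ σ · K₂ w′

    prefixLift-∷ : ∀ {l l′} c → PrefixLift l l′ → PrefixLift (c ∷ l) (c ∷ l′)
    prefixLift-∷ c lift [] = [] , 1# , [] , z≤n , sym (·-identityˡ (1# , 0#))
    prefixLift-∷ c lift (refl ∷ p′) =
      let w , σ , p , |w|≤ , K₂w≡ = lift p′
      in c ∷ w , σ , refl ∷ p , s≤s |w|≤ , trans (cong (step c) K₂w≡) (step-· c σ _)

    infixLift-∷ : ∀ {c c′ l l′} → PrefixLift (c ∷ l) (c′ ∷ l′) → InfixLift l l′ → InfixLift (c ∷ l) (c′ ∷ l′)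
    infixLift-∷ plift ilift (here p′) =
      let w , σ , p , |w|≤ , K₂w≡ = plift p′ in w , σ , here p , |w|≤ , cong proj₁ K₂w≡
    infixLift-∷ plift ilift (there i′) =
      let w , σ , i , |w|≤ , Kw≡ = ilift i′ in w , σ , there i , |w|≤ , Kw≡

    infixLift-[] : ∀ {l} → InfixLift l []
    infixLift-[] (here []) = [] , 1# , here [] , z≤n , sym (*-identityˡ 1#)

    record Reduction (l l′ : List (𝒪 d)) : Set where
      field
        length-suc : length l ≡ suc (length l′)
        K≡0⇒K′≡0 : K l ≡ 0# → K l′ ≡ 0#
        infixLift : InfixLift l l′
        ∈ℤ-back : All _∈ℤ l′ → All _∈ℤ l

    -- Unlike a reduction at the first entry, these survive prepending entries (innerReduction-∷).
    record InnerReduction (l l′ : List (𝒪 d)) : Set where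
      field
        unit : 𝒪 d
        isUnit : IsUnit unit
        length-suc : length l ≡ suc (length l′)
        K₂-scaled : K₂ l ≡ unit · K₂ l′
        prefixLift : PrefixLift l l′
        infixLift : InfixLift l l′
        ∈ℤ-back : All _∈ℤ l′ → All _∈ℤ l

    innerReduction-∷ : ∀ {l l′} c → InnerReduction l l′ → InnerReduction (c ∷ l) (c ∷ l′)
    innerReduction-∷ c r = record
      { unit = unit
      ; isUnit = isUnit
      ; length-suc = cong suc length-suc
      ; K₂-scaled = trans (cong (step c) K₂-scaled) (step-· c unit _)
      ; prefixLift = prefixLift-∷ c prefixLift
      ; infixLift = infixLift-∷ (prefixLift-∷ c prefixLift) infixLift
      ; ∈ℤ-back = λ { (c∈ℤ ∷ l′∈ℤ) → c∈ℤ ∷ ∈ℤ-back l′∈ℤ }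
      }
      where open InnerReduction r

    innerReduction⇒reduction : ∀ {l l′} → InnerReduction l l′ → Reduction l l′
    innerReduction⇒reduction r = record
      { length-suc = length-suc
      ; K≡0⇒K′≡0 = λ K≡0 → unit*x≡0⇒x≡0 isUnit (trans (sym (cong proj₁ K₂-scaled)) K≡0)
      ; infixLift = infixLift
      ; ∈ℤ-back = ∈ℤ-back
      }
      where open InnerReduction r

    module _ {ε} (u : IsUnit ε) where
      private
        ε∈ℤ : ε ∈ℤ
        ε∈ℤ = unit-∈ℤ u

        x-ε∈ℤ⇒x∈ℤ : ∀ x → (x - ε) ∈ℤ → x ∈ℤ
        x-ε∈ℤ⇒x∈ℤ x = x-y∈ℤ⇒x∈ℤ x ε ε∈ℤ

        K-unit-first : ∀ y w → K (ε ∷ y ∷ w) ≡ ε * K (y - ε ∷ w)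
        K-unit-first y w = cong proj₂ (step-unit u 0# y (K₂ w))

      infixLift-first : ∀ y v → InfixLift (ε ∷ y ∷ v) (y - ε ∷ v)
      infixLift-first y v (here []) = [] , 1# , here [] , z≤n , sym (*-identityˡ 1#)
      infixLift-first y v (here (_∷_ {as = w} refl p)) =
        ε ∷ y ∷ w , ε , here (refl ∷ refl ∷ p) , ℕP.≤-refl , K-unit-first y w
      infixLift-first y v (there i) = _ , 1# , there (there i) , ℕP.n≤1+n _ , sym (*-identityˡ _)

      reduce-first : ∀ y v → Reduction (ε ∷ y ∷ v) (y - ε ∷ v)
      reduce-first y v = record
        { length-suc = refl
        ; K≡0⇒K′≡0 = λ K≡0 → unit*x≡0⇒x≡0 u (trans (sym (K-unit-first y v)) K≡0)
        ; infixLift = infixLift-first y v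
        ; ∈ℤ-back = λ { (y-ε∈ℤ ∷ v∈ℤ) → ε∈ℤ ∷ x-ε∈ℤ⇒x∈ℤ y y-ε∈ℤ ∷ v∈ℤ }
        }

      reduce-inner : ∀ x y v → InnerReduction (x ∷ ε ∷ y ∷ v) (x - ε ∷ y - ε ∷ v)
      reduce-inner x y v = record
        { unit = ε
        ; isUnit = u
        ; length-suc = refl
        ; K₂-scaled = step-unit u x y (K₂ v)
        ; prefixLift = prefixLift
        ; infixLift = infixLift-∷ prefixLift (infixLift-first y v)
        ; ∈ℤ-back = λ { (x-ε∈ℤ ∷ y-ε∈ℤ ∷ v∈ℤ) → x-ε∈ℤ⇒x∈ℤ x x-ε∈ℤ ∷ ε∈ℤ ∷ x-ε∈ℤ⇒x∈ℤ y y-ε∈ℤ ∷ v∈ℤ }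
        }
        where
        prefixLift : PrefixLift (x ∷ ε ∷ y ∷ v) (x - ε ∷ y - ε ∷ v)
        prefixLift [] = [] , 1# , [] , z≤n , sym (·-identityˡ _)
        prefixLift (refl ∷ []) = x ∷ ε ∷ [] , ε , refl ∷ refl ∷ [] , ℕP.≤-refl , step-unit-last u x
        prefixLift (refl ∷ refl ∷ p) = x ∷ ε ∷ y ∷ _ , ε , refl ∷ refl ∷ refl ∷ p , ℕP.≤-refl , step-unit u x y _

      reduce-last : ∀ x → InnerReduction (x ∷ ε ∷ []) (x - ε ∷ [])
      reduce-last x = record
        { unit = ε
        ; isUnit = u
        ; length-suc = refl
        ; K₂-scaled = step-unit-last u x
        ; prefixLift = prefixLift
        ; infixLift = infixLift-∷ prefixLift infixLift-[]
        ; ∈ℤ-back = λ { (x-ε∈ℤ ∷ []) → x-ε∈ℤ⇒x∈ℤ x x-ε∈ℤ ∷ ε∈ℤ ∷ [] }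
        }
        where
        prefixLift : PrefixLift (x ∷ ε ∷ []) (x - ε ∷ [])
        prefixLift [] = [] , 1# , [] , z≤n , sym (·-identityˡ _)
        prefixLift (refl ∷ []) = x ∷ ε ∷ [] , ε , refl ∷ refl ∷ [] , ℕP.≤-refl , step-unit-last u x

    innerReduction : ∀ x {l} → Any IsUnit l → ∃ (InnerReduction (x ∷ l))
    innerReduction x (here {xs = []} u) = _ , reduce-last u x
    innerReduction x (here {xs = y ∷ v} u) = _ , reduce-inner u x y v
    innerReduction x (there {x = c} any) = Product.map (x ∷_) (innerReduction-∷ x) (innerReduction c any)

    reduction : ∀ {l} → Any IsUnit l → 2 ℕ.≤ length l → ∃ (Reduction l)
    reduction (here {xs = y ∷ v} u) _ = _ , reduce-first u y v
    reduction (there {x = x} any) _ = Product.map₂ innerReduction⇒reduction (innerReduction x any)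
    reduction (here {xs = []} u) (s≤s ())

    -- as satisfied by n + 2 consecutive entries a i , … , a (i + n + 1) of the quiddity row of a frieze of height n
    record Quiddity (l : List (𝒪 d)) : Set where
      field
        K≡0 : K l ≡ 0#
        infix-K≢0 : ∀ {w} → Infix _≡_ w l → length w ℕ.< length l → K w ≢ 0#

    quiddity-reduction : ∀ {l l′} → Reduction l l′ → Quiddity l → Quiddity l′
    quiddity-reduction r q = record
      { K≡0 = K≡0⇒K′≡0 K≡0
      ; infix-K≢0 = λ i′ |w′|<|l′| Kw′≡0 →
          let w , σ , i , |w|≤ , Kw≡ = infixLift i′
          in infix-K≢0 i (subst (length w ℕ.<_) (sym length-suc) (ℕP.≤-<-trans |w|≤ (s≤s |w′|<|l′|)))
               (trans Kw≡ (trans (cong (σ *_) Kw′≡0) (*-zeroʳ σ)))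
      }
      where
      open Reduction r
      open Quiddity q

    module _ (Δ<-12 : discriminant d ℤ.< ℤ.- + 12) where

      K₂-growth : ∀ {l} → All (λ c → + 4 ℤ.≤ N c) l → N (proj₂ (K₂ l)) ℤ.< N (K l)
      K₂-growth [] = subst₂ ℤ._<_ (sym (N-ι (+ 0))) (sym (N-ι (+ 1))) (+<+ (s≤s z≤n))
      K₂-growth {c ∷ l} (4≤Nc ∷ 4≤N) = N-growth Δ<-12 c (K l) (proj₂ (K₂ l)) 4≤Nc (K₂-growth 4≤N)

      large-entries⇒K≢0 : ∀ {l} → All (λ c → + 4 ℤ.≤ N c) l → K l ≢ 0#
      large-entries⇒K≢0 {l} 4≤N K≡0 =
        ℤP.<⇒≱ (subst (N (proj₂ (K₂ l)) ℤ.<_) (trans (cong N K≡0) (N-ι (+ 0))) (K₂-growth 4≤N))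
               (0≤N Δ<-12 (proj₂ (K₂ l)))

      quiddity-has-unit : ∀ {l} → Quiddity l → 2 ℕ.≤ length l → Any IsUnit l
      quiddity-has-unit {l} q 2≤|l| = units (λ i c≡0 → infix-K≢0 i 2≤|l| (trans (K-singleton _) c≡0)) small
        where
        open Quiddity q
        small : Any (λ c → N c ℤ.< + 4) l
        small = [ (λ large → contradiction K≡0 (large-entries⇒K≢0 (All.map ℤP.≮⇒≥ large))) , id ]′
                  (All.search (λ c → N c ℤ.<? + 4) l)
        units : ∀ {l} → (∀ {c} → Infix _≡_ (c ∷ []) l → c ≢ 0#) → Any (λ c → N c ℤ.< + 4) l → Any IsUnit l
        units c≢0 (here Nc<4) =
          here ([ (λ c≡0 → contradiction c≡0 (c≢0 (here (refl ∷ [])))) , id ]′ (N<4⇒≡0∨unit Δ<-12 _ Nc<4))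
        units c≢0 (there any) = there (units (c≢0 ∘ there) any)

      quiddity-∈ℤ : ∀ l → Quiddity l → All _∈ℤ l
      quiddity-∈ℤ = wfRec (λ l → Quiddity l → All _∈ℤ l) reduce
        where
        open WF.All (On.wellFounded length ℕI.<-wellFounded) 0ℓ using (wfRec)
        reduce : ∀ l → (∀ {l′} → length l′ ℕ.< length l → Quiddity l′ → All _∈ℤ l′) → Quiddity l → All _∈ℤ l
        reduce [] _ _ = []
        reduce (c ∷ []) _ q = cong 𝒪.im (trans (sym (K-singleton c)) (Quiddity.K≡0 q)) ∷ []
        reduce (_ ∷ _ ∷ _) rec q =
          let l′ , r = reduction (quiddity-has-unit q (s≤s (s≤s z≤n))) (s≤s (s≤s z≤n))
          in Reduction.∈ℤ-back r (rec (ℕP.≤-reflexive (sym (Reduction.length-suc r))) (quiddity-reduction r q))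

    -- Friezes

    det : 𝒪 d → 𝒪 d → 𝒪 d → 𝒪 d → 𝒪 d
    det a b e f = a * f - b * e

    det-cong : ∀ {a a′ b b′ e e′ f f′} → a ≡ a′ → b ≡ b′ → e ≡ e′ → f ≡ f′ → det a b e f ≡ det a′ b′ e′ f′
    det-cong refl refl refl refl = refl

    -- diag i m is the entry c i (i + m)
    record DiagonalFrieze (n : ℕ) : Set where
      field
        diag : ℤ → ℕ → 𝒪 d
        diag-0 : ∀ i → diag i 0 ≡ 0#
        diag-1 : ∀ i → diag i 1 ≡ 1#
        diag-2+n : ∀ i → diag i (2 ℕ.+ n) ≡ 1#
        diag-3+n : ∀ i → diag i (3 ℕ.+ n) ≡ 0#
        diag≢0 : ∀ i m → 2 ℕ.≤ m → m ℕ.≤ 1 ℕ.+ n → diag i m ≢ 0#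
        diag-unimodular : ∀ i m → m ℕ.≤ 1 ℕ.+ n →
          det (diag i (1 ℕ.+ m)) (diag i (2 ℕ.+ m)) (diag (i ℤ.+ + 1) m) (diag (i ℤ.+ + 1) (1 ℕ.+ m)) ≡ 1#

    private
      det-shift : (c : ℤ → ℤ → 𝒪 d) → ∀ i m → let j = i ℤ.+ + suc m in
        det (c i j) (c i (j ℤ.+ + 1)) (c (i ℤ.+ + 1) j) (c (i ℤ.+ + 1) (j ℤ.+ + 1))
        ≡ det (c i j) (c i (i ℤ.+ + (2 ℕ.+ m))) (c (i ℤ.+ + 1) (i ℤ.+ + 1 ℤ.+ + m)) (c (i ℤ.+ + 1) (i ℤ.+ + 1 ℤ.+ + suc m))
      det-shift c i m = det-cong (refl {x = c i (i ℤ.+ + suc m)})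
        (cong (c i) ([i+j]+1≡i+[1+j] i (+ suc m)))
        (cong (c (i ℤ.+ + 1)) (i+[1+j]≡[i+1]+j i (+ m)))
        (cong (c (i ℤ.+ + 1)) (trans ([i+j]+1≡i+[1+j] i (+ suc m)) (i+[1+j]≡[i+1]+j i (+ suc m))))

    toDiagonal : ∀ {n} → Frieze d n → DiagonalFrieze n
    toDiagonal {n} F = record
      { diag = λ i m → c i (i ℤ.+ + m)
      ; diag-0 = λ i → trans (cong (c i) (ℤP.+-identityʳ i)) (zeroˡ i)
      ; diag-1 = oneˡ
      ; diag-2+n = λ i → trans (cong (c i) (sym (n+i+k≡i+[k+n] (+ 2) i (+ n)))) (oneʳ i)
      ; diag-3+n = λ i → trans (cong (c i) (sym (n+i+k≡i+[k+n] (+ 3) i (+ n)))) (zeroʳ i)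
      ; diag≢0 = λ i m 2≤m m≤1+n → nonzero i (i ℤ.+ + m) (ℤP.+-monoʳ-≤ i (+≤+ 2≤m)) (i+m≤n+i+k 1 i m m≤1+n)
      ; diag-unimodular = λ i m m≤1+n → trans (sym (det-shift c i m))
          (unimod i (i ℤ.+ + suc m) (ℤP.+-monoʳ-≤ i (+≤+ (s≤s z≤n))) (i+m≤n+i+k 2 i (suc m) (s≤s m≤1+n)))
      }
      where
      open Frieze F
      i+m≤n+i+k : ∀ k i m → m ℕ.≤ k ℕ.+ n → i ℤ.+ + m ℤ.≤ + n ℤ.+ i ℤ.+ + k
      i+m≤n+i+k k i m m≤k+n = subst (i ℤ.+ + m ℤ.≤_) (sym (n+i+k≡i+[k+n] (+ k) i (+ n))) (ℤP.+-monoʳ-≤ i (+≤+ m≤k+n))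

    fromDiagonal : ∀ {n} → DiagonalFrieze n → Frieze d n
    fromDiagonal {n} D = record
      { c = c
      ; zeroˡ = λ i → trans (cong (λ k → diag i ℤ.∣ k ∣) (ℤP.+-inverseʳ i)) (diag-0 i)
      ; zeroʳ = λ i → trans (cong (c i) (n+i+k≡i+[k+n] (+ 3) i (+ n))) (trans (c-offset i (3 ℕ.+ n)) (diag-3+n i))
      ; oneˡ = λ i → trans (c-offset i 1) (diag-1 i)
      ; oneʳ = λ i → trans (cong (c i) (n+i+k≡i+[k+n] (+ 2) i (+ n))) (trans (c-offset i (2 ℕ.+ n)) (diag-2+n i))
      ; nonzero = nonzero
      ; unimod = unimod
      }
      where
      open DiagonalFrieze D
      c : ℤ → ℤ → 𝒪 d
      c i j = diag i ℤ.∣ j ℤ.- i ∣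
      c-offset : ∀ i m → c i (i ℤ.+ + m) ≡ diag i m
      c-offset i m = cong (λ k → diag i ℤ.∣ k ∣) ([i+j]-i≡j i (+ m))
      j≤i+[k+n] : ∀ k i j → j ℤ.≤ + n ℤ.+ i ℤ.+ + k → j ℤ.≤ i ℤ.+ + (k ℕ.+ n)
      j≤i+[k+n] k i j = subst (j ℤ.≤_) (n+i+k≡i+[k+n] (+ k) i (+ n))
      nonzero : ∀ i j → i ℤ.+ + 2 ℤ.≤ j → j ℤ.≤ + n ℤ.+ i ℤ.+ + 1 → c i j ≢ 0#
      nonzero i j lo hi with between i j 2 (1 ℕ.+ n) lo (j≤i+[k+n] 1 i j hi)
      ... | m , refl , 2≤m , m≤1+n = λ c≡0 → diag≢0 i m 2≤m m≤1+n (trans (sym (c-offset i m)) c≡0)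
      unimod : ∀ i j → i ℤ.+ + 1 ℤ.≤ j → j ℤ.≤ + n ℤ.+ i ℤ.+ + 2 →
        det (c i j) (c i (j ℤ.+ + 1)) (c (i ℤ.+ + 1) j) (c (i ℤ.+ + 1) (j ℤ.+ + 1)) ≡ 1#
      unimod i j lo hi with between i j 1 (2 ℕ.+ n) lo (j≤i+[k+n] 2 i j hi)
      ... | suc m , refl , _ , s≤s m≤1+n = begin
        det (c i j) (c i (j ℤ.+ + 1)) (c (i ℤ.+ + 1) j) (c (i ℤ.+ + 1) (j ℤ.+ + 1))
          ≡⟨ det-shift c i m ⟩
        det (c i j) (c i (i ℤ.+ + (2 ℕ.+ m))) (c (i ℤ.+ + 1) (i ℤ.+ + 1 ℤ.+ + m)) (c (i ℤ.+ + 1) (i ℤ.+ + 1 ℤ.+ + suc m))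
          ≡⟨ det-cong (c-offset i (suc m)) (c-offset i (2 ℕ.+ m)) (c-offset (i ℤ.+ + 1) m) (c-offset (i ℤ.+ + 1) (suc m)) ⟩
        det (diag i (1 ℕ.+ m)) (diag i (2 ℕ.+ m)) (diag (i ℤ.+ + 1) m) (diag (i ℤ.+ + 1) (1 ℕ.+ m))
          ≡⟨ diag-unimodular i m m≤1+n ⟩
        1# ∎
        where open ≡-Reasoning

    module _ (Δ<-12 : discriminant d ℤ.< ℤ.- + 12) {n} (F : DiagonalFrieze n) where
      open DiagonalFrieze F
      open import Algebra.Properties.Group (CommutativeRing.+-group 𝒪-commutativeRing)
        using (x≈y⇒x∙y⁻¹≈ε; x∙y⁻¹≈ε⇒x≈y)

      quiddity : ℤ → 𝒪 d
      quiddity i = diag i 2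

      diag-suc≢0 : ∀ i m → m ℕ.≤ 1 ℕ.+ n → diag i (suc m) ≢ 0#
      diag-suc≢0 i zero _ diag≡0 = contradiction (trans (sym (diag-1 i)) diag≡0) λ ()
      diag-suc≢0 i (suc m) 1+m≤1+n with ℕP.m≤n⇒m<n∨m≡n 1+m≤1+n
      ... | inj₁ 2+m≤1+n = diag≢0 i (2 ℕ.+ m) (s≤s (s≤s z≤n)) 2+m≤1+n
      ... | inj₂ refl = λ diag≡0 → contradiction (trans (sym (diag-2+n i)) diag≡0) λ ()

      diag-recurrence : ∀ i m → m ℕ.≤ 1 ℕ.+ n →
        diag i (2 ℕ.+ m) ≡ quiddity i * diag (i ℤ.+ + 1) (1 ℕ.+ m) - diag (i ℤ.+ + 1 ℤ.+ + 1) m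
      diag-recurrence i zero _ = begin
        diag i 2
          ≡⟨ solve 1 (λ x → x := x :* con (+ 1) :- con (+ 0)) refl (diag i 2) ⟩
        quiddity i * 1# - 0#
          ≡⟨ cong₂ (λ x y → quiddity i * x - y) (diag-1 (i ℤ.+ + 1)) (diag-0 (i ℤ.+ + 1 ℤ.+ + 1)) ⟨
        quiddity i * diag (i ℤ.+ + 1) 1 - diag (i ℤ.+ + 1 ℤ.+ + 1) 0 ∎
        where open ≡-Reasoning
      diag-recurrence i (suc m) 1+m≤1+n =
        x∙y⁻¹≈ε⇒x≈y R (a * Q - U) (x*y≡0∧x≢0⇒y≡0 Δ<-12 S _ S[R-aQ+U]≡0 (diag-suc≢0 (i ℤ.+ + 1) m m≤1+n))
        where
        open ≡-Reasoning
        m≤1+n : m ℕ.≤ 1 ℕ.+ n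
        m≤1+n = ℕP.m≤n⇒m≤1+n (ℕP.≤-pred 1+m≤1+n)
        a P Q R S U V : 𝒪 d
        a = quiddity i
        P = diag i (2 ℕ.+ m)
        Q = diag (i ℤ.+ + 1) (2 ℕ.+ m)
        R = diag i (3 ℕ.+ m)
        S = diag (i ℤ.+ + 1) (1 ℕ.+ m)
        U = diag (i ℤ.+ + 1 ℤ.+ + 1) (1 ℕ.+ m)
        V = diag (i ℤ.+ + 1 ℤ.+ + 1) m
        S[R-aQ+U]≡0 : S * (R - (a * Q - U)) ≡ 0#
        S[R-aQ+U]≡0 = begin
          S * (R - (a * Q - U))
            ≡⟨ solve 7 (λ a P Q R S U V → S :* (R :- (a :* Q :- U)) :=
                 Q :* (P :- (a :* S :- V)) :- (P :* Q :- R :* S :- con (+ 1)) :+ (S :* U :- Q :* V :- con (+ 1)))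
               refl a P Q R S U V ⟩
          Q * (P - (a * S - V)) - (det P R S Q - 1#) + (det S Q V U - 1#)
            ≡⟨ cong₂ (λ x y → Q * x - y + (det S Q V U - 1#))
                 (x≈y⇒x∙y⁻¹≈ε (diag-recurrence i m m≤1+n)) (x≈y⇒x∙y⁻¹≈ε (diag-unimodular i (suc m) 1+m≤1+n)) ⟩
          Q * 0# - 0# + (det S Q V U - 1#)
            ≡⟨ cong (λ z → Q * 0# - 0# + z) (x≈y⇒x∙y⁻¹≈ε (diag-unimodular (i ℤ.+ + 1) m m≤1+n)) ⟩
          Q * 0# - 0# + 0#
            ≡⟨ solve 1 (λ Q → Q :* con (+ 0) :- con (+ 0) :+ con (+ 0) := con (+ 0)) refl Q ⟩
          0# ∎

      K₂-segment : ∀ i m → m ℕ.≤ 2 ℕ.+ n → K₂ (segment quiddity i m) ≡ (diag i (1 ℕ.+ m) , diag (i ℤ.+ + 1) m)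
      K₂-segment i zero _ = cong₂ _,_ (sym (diag-1 i)) (sym (diag-0 (i ℤ.+ + 1)))
      K₂-segment i (suc m) (s≤s m≤1+n) = begin
        K₂ (segment quiddity i (suc m))
          ≡⟨ cong (step (quiddity i)) (K₂-segment (i ℤ.+ + 1) m (ℕP.m≤n⇒m≤1+n m≤1+n)) ⟩
        step (quiddity i) (diag (i ℤ.+ + 1) (1 ℕ.+ m) , diag (i ℤ.+ + 1 ℤ.+ + 1) m)
          ≡⟨ cong (_, diag (i ℤ.+ + 1) (1 ℕ.+ m)) (diag-recurrence i m m≤1+n) ⟨
        diag i (2 ℕ.+ m) , diag (i ℤ.+ + 1) (1 ℕ.+ m) ∎
        where open ≡-Reasoning

      segment-quiddity : ∀ i → Quiddity (segment quiddity i (2 ℕ.+ n))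
      segment-quiddity i = record
        { K≡0 = trans (cong proj₁ (K₂-segment i (2 ℕ.+ n) ℕP.≤-refl)) (diag-3+n i)
        ; infix-K≢0 = λ {w} w-infix |w|<|l| Kw≡0 →
            let j , w≡segment = infix-segment quiddity i (2 ℕ.+ n) w-infix
                |w|<2+n = subst (length w ℕ.<_) (length-segment quiddity i (2 ℕ.+ n)) |w|<|l|
            in diag-suc≢0 j (length w) (ℕP.≤-pred |w|<2+n)
                 (trans (cong proj₁ (sym (K₂-segment j (length w) (ℕP.<⇒≤ |w|<2+n))))
                        (trans (cong K (sym w≡segment)) Kw≡0))
        }

      quiddity-row-∈ℤ : ∀ i → quiddity i ∈ℤ
      quiddity-row-∈ℤ i = All.head (quiddity-∈ℤ Δ<-12 _ (segment-quiddity i))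

      diag-∈ℤ : ∀ i m → m ℕ.≤ 3 ℕ.+ n → diag i m ∈ℤ
      diag-∈ℤ i zero _ = cong 𝒪.im (diag-0 i)
      diag-∈ℤ i (suc m) (s≤s m≤2+n) =
        subst _∈ℤ (cong proj₁ (K₂-segment i m m≤2+n)) (proj₁ (K₂-∈ℤ (All-segment quiddity quiddity-row-∈ℤ i m)))

    module _ (Δ<-12 : discriminant d ℤ.< ℤ.- + 12) where

      frieze-entry-∈ℤ : ∀ {n} (F : Frieze d n) i j → i ℤ.≤ j → j ℤ.≤ + n ℤ.+ i ℤ.+ + 3 → Frieze.c F i j ∈ℤ
      frieze-entry-∈ℤ {n} F i j lo hi
        with between i j 0 (3 ℕ.+ n) (subst (ℤ._≤ j) (sym (ℤP.+-identityʳ i)) lo)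
                                     (subst (j ℤ.≤_) (n+i+k≡i+[k+n] (+ 3) i (+ n)) hi)
      ... | m , refl , _ , m≤3+n = diag-∈ℤ Δ<-12 (toDiagonal F) i m m≤3+n

      frieze-subring-∈ℤ : ∀ {x} → InFriezeSubring d x → x ∈ℤ
      frieze-subring-∈ℤ (entry (_ , F , i , j , lo , hi , refl)) = frieze-entry-∈ℤ F i j lo hi
      frieze-subring-∈ℤ zero = refl
      frieze-subring-∈ℤ one = refl
      frieze-subring-∈ℤ (add {x} {y} x∈ y∈) = ∈ℤ-+ x y (frieze-subring-∈ℤ x∈) (frieze-subring-∈ℤ y∈)
      frieze-subring-∈ℤ (neg {x} x∈) = ∈ℤ-neg x (frieze-subring-∈ℤ x∈)
      frieze-subring-∈ℤ (mul {x} {y} x∈ y∈) = ∈ℤ-* x y (frieze-subring-∈ℤ x∈) (frieze-subring-∈ℤ y∈)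

    -- The exceptional friezes

    alternating : ∀ {n} (ρ : Bool → ℕ → 𝒪 d) →
      (∀ b → ρ b 0 ≡ 0#) → (∀ b → ρ b 1 ≡ 1#) → (∀ b → ρ b (2 ℕ.+ n) ≡ 1#) → (∀ b → ρ b (3 ℕ.+ n) ≡ 0#) →
      (∀ b m → 2 ℕ.≤ m → m ℕ.≤ 1 ℕ.+ n → ρ b m ≢ 0#) →
      (∀ b m → m ℕ.≤ 1 ℕ.+ n → det (ρ b (1 ℕ.+ m)) (ρ b (2 ℕ.+ m)) (ρ (not b) m) (ρ (not b) (1 ℕ.+ m)) ≡ 1#) →
      DiagonalFrieze n
    alternating ρ ρ-0 ρ-1 ρ-2+n ρ-3+n ρ≢0 ρ-unimodular = record
      { diag = λ i → ρ (isEven i)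
      ; diag-0 = λ i → ρ-0 (isEven i)
      ; diag-1 = λ i → ρ-1 (isEven i)
      ; diag-2+n = λ i → ρ-2+n (isEven i)
      ; diag-3+n = λ i → ρ-3+n (isEven i)
      ; diag≢0 = λ i → ρ≢0 (isEven i)
      ; diag-unimodular = λ i m m≤1+n →
          subst (λ b → det (ρ (isEven i) (1 ℕ.+ m)) (ρ (isEven i) (2 ℕ.+ m)) (ρ b m) (ρ b (1 ℕ.+ m)) ≡ 1#)
            (sym (isEven-suc i)) (ρ-unimodular (isEven i) m m≤1+n)
      }

    private
      pick : 𝒪 d → 𝒪 d → Bool → 𝒪 d
      pick α β b = if b then α else β

      factors≢0 : ∀ α β {k} → α * β ≡ ι d (+ suc k) → α ≢ 0# × β ≢ 0#
      factors≢0 α β αβ≡k+1 =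
        (λ α≡0 → contradiction (trans (sym αβ≡k+1) (trans (cong (_* β) α≡0) (*-zeroˡ β))) λ ()) ,
        (λ β≡0 → contradiction (trans (sym αβ≡k+1) (trans (cong (α *_) β≡0) (*-zeroʳ α))) λ ())

    row₁ : 𝒪 d → ℕ → 𝒪 d
    row₁ q 1 = 1#
    row₁ q 2 = q
    row₁ q 3 = 1#
    row₁ q _ = 0#

    row₃ : 𝒪 d → ℕ → 𝒪 d
    row₃ q 1 = 1#
    row₃ q 2 = q
    row₃ q 3 = ι d (+ 2)
    row₃ q 4 = q
    row₃ q 5 = 1#
    row₃ q _ = 0#

    row₁-unimodular : ∀ {p q} → p * q ≡ ι d (+ 2) → ∀ m → m ℕ.≤ 2 →
      det (row₁ p (1 ℕ.+ m)) (row₁ p (2 ℕ.+ m)) (row₁ q m) (row₁ q (1 ℕ.+ m)) ≡ 1#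
    row₁-unimodular {p} _ 0 _ = solve 1 (λ p → con (+ 1) :* con (+ 1) :- p :* con (+ 0) := con (+ 1)) refl p
    row₁-unimodular pq≡2 1 _ =
      trans (cong (_- 1# * 1#) pq≡2) (solve 0 (con (+ 2) :- con (+ 1) :* con (+ 1) := con (+ 1)) refl)
    row₁-unimodular {q = q} _ 2 _ = solve 1 (λ q → con (+ 1) :* con (+ 1) :- con (+ 0) :* q := con (+ 1)) refl q
    row₁-unimodular _ (suc (suc (suc _))) (s≤s (s≤s ()))

    row₃-unimodular : ∀ {p q} → p * q ≡ ι d (+ 3) → ∀ m → m ℕ.≤ 4 →
      det (row₃ p (1 ℕ.+ m)) (row₃ p (2 ℕ.+ m)) (row₃ q m) (row₃ q (1 ℕ.+ m)) ≡ 1#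
    row₃-unimodular {p} _ 0 _ = solve 1 (λ p → con (+ 1) :* con (+ 1) :- p :* con (+ 0) := con (+ 1)) refl p
    row₃-unimodular pq≡3 1 _ =
      trans (cong (_- ι d (+ 2) * 1#) pq≡3) (solve 0 (con (+ 3) :- con (+ 2) :* con (+ 1) := con (+ 1)) refl)
    row₃-unimodular pq≡3 2 _ =
      trans (cong (λ x → ι d (+ 2) * ι d (+ 2) - x) pq≡3) (solve 0 (con (+ 2) :* con (+ 2) :- con (+ 3) := con (+ 1)) refl)
    row₃-unimodular pq≡3 3 _ =
      trans (cong (_- 1# * ι d (+ 2)) pq≡3) (solve 0 (con (+ 3) :- con (+ 1) :* con (+ 2) := con (+ 1)) refl)
    row₃-unimodular {q = q} _ 4 _ = solve 1 (λ q → con (+ 1) :* con (+ 1) :- con (+ 0) :* q := con (+ 1)) refl q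
    row₃-unimodular _ (suc (suc (suc (suc (suc _))))) (s≤s (s≤s (s≤s (s≤s ()))))

    height-1 : ∀ {α β} → α * β ≡ ι d (+ 2) → DiagonalFrieze 1
    height-1 {α} {β} αβ≡2 = alternating (λ b → row₁ (pick α β b)) (λ _ → refl) (λ _ → refl) (λ _ → refl) (λ _ → refl)
      (λ { true 2 _ _ → proj₁ (factors≢0 α β αβ≡2)
         ; false 2 _ _ → proj₂ (factors≢0 α β αβ≡2)
         ; _ (suc (suc (suc _))) _ (s≤s (s≤s ()))
         })
      (λ { true → row₁-unimodular αβ≡2 ; false → row₁-unimodular (trans (*-comm β α) αβ≡2) })

    height-3 : ∀ {α β} → α * β ≡ ι d (+ 3) → DiagonalFrieze 3
    height-3 {α} {β} αβ≡3 = alternating (λ b → row₃ (pick α β b)) (λ _ → refl) (λ _ → refl) (λ _ → refl) (λ _ → refl)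
      (λ { true 2 _ _ → proj₁ (factors≢0 α β αβ≡3)
         ; false 2 _ _ → proj₂ (factors≢0 α β αβ≡3)
         ; _ 3 _ _ → λ ()
         ; true 4 _ _ → proj₁ (factors≢0 α β αβ≡3)
         ; false 4 _ _ → proj₂ (factors≢0 α β αβ≡3)
         ; _ (suc (suc (suc (suc (suc _))))) _ (s≤s (s≤s (s≤s (s≤s ()))))
         })
      (λ { true → row₃-unimodular αβ≡3 ; false → row₃-unimodular (trans (*-comm β α) αβ≡3) })

    height-1-entry : ∀ {α β} → α * β ≡ ι d (+ 2) → IsFriezeEntry d α
    height-1-entry αβ≡2 = 1 , fromDiagonal (height-1 αβ≡2) , + 0 , + 2 , +≤+ z≤n , +≤+ (s≤s (s≤s z≤n)) , refl

    height-3-entry : ∀ {α β} → α * β ≡ ι d (+ 3) → IsFriezeEntry d α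
    height-3-entry αβ≡3 = 3 , fromDiagonal (height-3 αβ≡3) , + 0 , + 2 , +≤+ z≤n , +≤+ (s≤s (s≤s z≤n)) , refl

  ι-∈-subring : ∀ a → InFriezeSubring d (ι d a)
  ι-∈-subring (+ n) = ι+-∈-subring n
    where
    ι+-∈-subring : ∀ n → InFriezeSubring d (ι d (+ n))
    ι+-∈-subring zero = zero
    ι+-∈-subring (suc n) = add one (ι+-∈-subring n)
  ι-∈-subring -[1+ n ] = neg (ι-∈-subring (+ suc n))

  ω-generates : InFriezeSubring d ⟨ + 0 , + 1 ⟩ → ∀ x → InFriezeSubring d x
  ω-generates ω∈ ⟨ a , b ⟩ = subst (InFriezeSubring d) (sym a+bω) (add (ι-∈-subring a) (mul (ι-∈-subring b) ω∈))
    where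
    open +-*-Solver using (solve; _:=_; con)
    a+bω : ⟨ a , b ⟩ ≡ (ι d a +𝒪 (ι d b *𝒪 ⟨ + 0 , + 1 ⟩))
    a+bω = cong₂ ⟨_,_⟩
      (solve 4 (λ a b s t → let open Coordinates s t in
                  a := proj₁ ((a , con (+ 0)) ⊞ ((b , con (+ 0)) ⊠ (con (+ 0) , con (+ 1)))))
               refl a b (ωs d) (ωt d))
      (solve 4 (λ a b s t → let open Coordinates s t in
                  b := proj₂ ((a , con (+ 0)) ⊞ ((b , con (+ 0)) ⊠ (con (+ 0) , con (+ 1)))))
               refl a b (ωs d) (ωt d))

-- β = 2 / ω for d = −1, −2, −7 and β = 3 / ω for d = −3, −11
exceptional-ω-entry : ∀ {d} → Exceptional d → IsFriezeEntry d ⟨ + 0 , + 1 ⟩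
exceptional-ω-entry (inj₁ refl) = height-1-entry {β = ⟨ + 0 , ℤ.- + 2 ⟩} refl
exceptional-ω-entry (inj₂ (inj₁ refl)) = height-1-entry {β = ⟨ + 0 , ℤ.- + 1 ⟩} refl
exceptional-ω-entry (inj₂ (inj₂ (inj₁ refl))) = height-3-entry {β = ⟨ + 3 , ℤ.- + 3 ⟩} refl
exceptional-ω-entry (inj₂ (inj₂ (inj₂ (inj₁ refl)))) = height-1-entry {β = ⟨ + 1 , ℤ.- + 1 ⟩} refl
exceptional-ω-entry (inj₂ (inj₂ (inj₂ (inj₂ refl)))) = height-3-entry {β = ⟨ + 1 , ℤ.- + 1 ⟩} refl

-- The non-exceptional discriminants

discriminant≤ : ∀ m → discriminant -[1+ m ] ℤ.≤ -[1+ m ]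
discriminant≤ m with (-[1+ m ] %ℕ 4) ℕ.≡ᵇ 1
... | true = begin
  + 1 * + 1 + + 4 * q                      ≡⟨ 1+4q≡1+q*4 q ⟩
  + 1 + q * + 4                            ≤⟨ ℤP.+-monoʳ-≤ (+ 1) (ℤP.i≤j+i (q * + 4) (+ ((d - + 1) % + 4))) ⟩
  + 1 + (+ ((d - + 1) % + 4) + q * + 4)    ≡⟨ cong (λ x → + 1 + x) (a≡a%n+[a/n]*n (d - + 1) (+ 4)) ⟨
  + 1 + (d - + 1)                          ≡⟨ 1+[i-1]≡i d ⟩
  d                                        ∎
  where
  open Data.Integer using (_+_; _*_; _-_)
  open ℤP.≤-Reasoning
  d q : ℤ
  d = -[1+ m ]
  q = (d - + 1) / + 4
  1+4q≡1+q*4 : ∀ q → + 1 * + 1 + + 4 * q ≡ + 1 + q * + 4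
  1+4q≡1+q*4 = solve-∀
  1+[i-1]≡i : ∀ i → + 1 + (i - + 1) ≡ i
  1+[i-1]≡i = solve-∀
... | false = -≤- (ℕP.m≤m+n m _)

discriminant<-12 : ∀ d → d < + 0 → ¬ Exceptional d → discriminant d < ℤ.- + 12
discriminant<-12 (+ _) (+<+ ()) _
discriminant<-12 -[1+ m ] _ ¬exc with m ℕ.<? 12
... | no m≮12 = ℤP.≤-<-trans (discriminant≤ m) (-<- (ℕP.≰⇒> (m≮12 ∘ s≤s)))
... | yes m<12 = small m m<12 ¬exc
  where
  small : ∀ m → m ℕ.< 12 → ¬ Exceptional -[1+ m ] → discriminant -[1+ m ] < ℤ.- + 12
  small 0 _ ¬exc = contradiction (inj₁ refl) ¬exc
  small 1 _ ¬exc = contradiction (inj₂ (inj₁ refl)) ¬exc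
  small 2 _ ¬exc = contradiction (inj₂ (inj₂ (inj₁ refl))) ¬exc
  small 3 _ _ = from-yes (discriminant -[1+ 3 ] ℤ.<? ℤ.- + 12)
  small 4 _ _ = from-yes (discriminant -[1+ 4 ] ℤ.<? ℤ.- + 12)
  small 5 _ _ = from-yes (discriminant -[1+ 5 ] ℤ.<? ℤ.- + 12)
  small 6 _ ¬exc = contradiction (inj₂ (inj₂ (inj₂ (inj₁ refl)))) ¬exc
  small 7 _ _ = from-yes (discriminant -[1+ 7 ] ℤ.<? ℤ.- + 12)
  small 8 _ _ = from-yes (discriminant -[1+ 8 ] ℤ.<? ℤ.- + 12)
  small 9 _ _ = from-yes (discriminant -[1+ 9 ] ℤ.<? ℤ.- + 12)
  small 10 _ ¬exc = contradiction (inj₂ (inj₂ (inj₂ (inj₂ refl)))) ¬exc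
  small 11 _ _ = from-yes (discriminant -[1+ 11 ] ℤ.<? ℤ.- + 12)
  small (suc (suc (suc (suc (suc (suc (suc (suc (suc (suc (suc (suc _))))))))))))
        (s≤s (s≤s (s≤s (s≤s (s≤s (s≤s (s≤s (s≤s (s≤s (s≤s (s≤s (s≤s ())))))))))))) _

theorem5p2 : (d : ℤ) → d < + 0 → SquareFree d →
    (Exceptional d → ∀ (x : 𝒪 d) → InFriezeSubring d x) ×
    (¬ Exceptional d → ∀ (x : 𝒪 d) → InFriezeSubring d x ⇔ ∃ (λ (a : ℤ) → x ≡ ι d a))
theorem5p2 d d<0 _ = exceptional , non-exceptional
  where
  exceptional : Exceptional d → ∀ x → InFriezeSubring d x
  exceptional exc = ω-generates (entry (exceptional-ω-entry exc))

  non-exceptional : ¬ Exceptional d → ∀ x → InFriezeSubring d x ⇔ ∃ (λ a → x ≡ ι d a)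
  non-exceptional ¬exc x = mk⇔
    (λ x∈ → 𝒪.re x , ∈ℤ⇒ι x (frieze-subring-∈ℤ (discriminant<-12 d d<0 ¬exc) x∈))
    (λ { (a , refl) → ι-∈-subring a })
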